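{- Call a CI-structure on a finite set $E$ any subset $\mathcal{G}\subseteq\mathcal{A}_E=\{(ij|K):K\subseteq E,\ i\neq j\in E\setminus K\}$, and call $\mathcal{G}$ a matroid if it satisfies (MCI) and (SG) below (equivalently, $\mathcal{G}=[[M]]$ for a loopless matroid $M$ on $E$). There is no finite set $\mathcal{F}$ of CI-structures such that, for every finite set $E$ and every CI-structure $\mathcal{G}$ on $E$, $\mathcal{G}$ is a matroid if and only if no minor of $\mathcal{G}$ is isomorphic to a member of $\mathcal{F}$. Here (MCI): for pairwise distinct $i,j,\ell\in E$ and disjoint $K,L\subseteq E\setminus\{i,j,\ell\}$, $(ij|K)\notin\mathcal{G}$ implies $(i\ell|jKL)\in\mathcal{G}$; (SG): for pairwise distinct $i,j,\ell$ and $K\subseteq E\setminus\{i,j,\ell\}$, $(ij|K),(i\ell|jK)\in\mathcal{G}$ imply $(i\ell|K),(ij|\ell K)\in\mathcal{G}$.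
   Context: $(ij|K)$ and $(ji|K)$ denote the same element; concatenation denotes disjoint union (e.g. $jKL=\{j\}\cup K\cup L$). For a loopless matroid $M$ on $E$ with rank $r$, $[[M]]=\{(ij|K)\in\mathcal{A}_E: r(iK)+r(jK)=r(ijK)+r(K)\}$. For $A\subseteq E$, the deletion is $\mathcal{G}\setminus A=\{(ij|K)\in\mathcal{G}: ijK\subseteq E\setminus A\}$ (a CI-structure on $E\setminus A$) and the contraction is $\mathcal{G}/A=\{(ij|K)\in\mathcal{A}_{E\setminus A}: (ij|K\cup A)\in\mathcal{G}\}$. A minor of $\mathcal{G}$ is any CI-structure obtained from $\mathcal{G}$ by a (possibly empty) sequence of deletions and contractions. Two CI-structures are isomorphic if one is obtained from the other by a bijective relabeling of the ground sets. -}

module Defs where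

open import Data.Nat using (ℕ)
open import Data.Bool using (Bool; true)
open import Data.Fin using (Fin)
open import Data.Fin.Subset using (Subset; _∈_; _∉_; _⊆_; _∪_; _─_; ⊤; ⁅_⁆)
open import Data.Product using (Σ; ∃; _×_)
open import Data.Sum using (_⊎_)
open import Data.List using (List)
open import Data.List.Membership.Propositional using () renaming (_∈_ to _∈ₗ_)
open import Relation.Nullary using (¬_)
open import Relation.Binary.PropositionalEquality using (_≡_; _≢_)
open import Function using (Injective)
open import Function.Bundles using (_⇔_)

-- The CI-structure it denotes is the set of *valid* triples (ij|K)
-- (valid w.r.t. the ground set S) such that G i j K or G j i K is true;
-- thus (ij|K) and (ji|K) are identified, and every CI-structure arises.
Raw : ℕ → Set
Raw N = Fin N → Fin N → Subset N → Bool

Valid : ∀ {N} → Subset N → Fin N → Fin N → Subset N → Set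
Valid S i j K = i ∈ S × j ∈ S × K ⊆ S × i ≢ j × i ∉ K × j ∉ K

In : ∀ {N} → Subset N → Raw N → Fin N → Fin N → Subset N → Set
In S G i j K = Valid S i j K × (G i j K ≡ true ⊎ G j i K ≡ true)

-- Deletion of A ⊆ S: ground set S ∖ A, same raw data (membership in the
-- deletion is automatically restricted to triples with ijK ⊆ S ∖ A).
contractRaw : ∀ {N} → Raw N → Subset N → Raw N
contractRaw G A i j K = G i j (K ∪ A)

data Minor {N : ℕ} : Subset N → Raw N → Subset N → Raw N → Set where
  here : ∀ {S G} → Minor S G S G
  del  : ∀ {S G S' H} (A : Subset N) → A ⊆ S →
         Minor (S ─ A) G S' H → Minor S G S' H
  con  : ∀ {S G S' H} (A : Subset N) → A ⊆ S →
         Minor (S ─ A) (contractRaw G A) S' H → Minor S G S' H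

IsImage : ∀ {m N} → (Fin m → Fin N) → Subset m → Subset N → Set
IsImage f K K' = ∀ x → x ∈ K' ⇔ (∃ λ i → i ∈ K × f i ≡ x)

Isomorphic : ∀ {N m} → Subset N → Raw N → Raw m → Set
Isomorphic {N} {m} S G F =
  Σ (Fin m → Fin N) λ f →
    Injective _≡_ _≡_ f ×
    (∀ i → f i ∈ S) ×
    (∀ x → x ∈ S → ∃ λ i → f i ≡ x) ×
    (∀ i j K K' → IsImage f K K' → (In ⊤ F i j K ⇔ In S G (f i) (f j) K'))

MCI : ∀ {n} → Raw n → Set
MCI {n} G = ∀ (i j l : Fin n) (K L : Subset n) →
  i ≢ j → i ≢ l → j ≢ l →
  i ∉ K → j ∉ K → l ∉ K → i ∉ L → j ∉ L → l ∉ L →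
  (∀ x → x ∈ K → x ∉ L) →
  ¬ In ⊤ G i j K → In ⊤ G i l (⁅ j ⁆ ∪ K ∪ L)

SG : ∀ {n} → Raw n → Set
SG {n} G = ∀ (i j l : Fin n) (K : Subset n) →
  i ≢ j → i ≢ l → j ≢ l → i ∉ K → j ∉ K → l ∉ K →
  In ⊤ G i j K → In ⊤ G i l (⁅ j ⁆ ∪ K) →
  In ⊤ G i l K × In ⊤ G i j (⁅ l ⁆ ∪ K)

IsMatroid : ∀ {n} → Raw n → Set
IsMatroid G = MCI G × SG G

CIFamily : Set
CIFamily = List (Σ ℕ Raw)

HasMinorIn : ∀ {n} → Raw n → CIFamily → Set
HasMinorIn {n} G 𝓕 =
  ∃ λ (S' : Subset n) → ∃ λ (H : Raw n) → Minor ⊤ G S' H ×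
  ∃ λ (F : Σ ℕ Raw) → F ∈ₗ 𝓕 × Isomorphic S' H (Data.Product.proj₂ F)

-- Let 𝒢ₙ be the CI-structure on an n-set E in which (ij|K) holds iff K ≠ ∅ and ijK ≠ E.
-- For n ≥ 3 it violates (MCI): (ij|∅) fails, so (MCI) would force (il|jL) for L = E ∖ ijl,
-- yet ijlL = E. A proper minor contracts some C and restricts to some S ≠ E, where (ij|K)
-- holds iff KC ≠ ∅ and ijKC ≠ E; a point outside S escapes ijKC whenever KC = ∅, which
-- is what makes (MCI) hold, while (SG) holds because the spanning conditions of (il|jK)
-- and (ij|lK) concern the same set ijlKC. So every 𝒢ₙ is an excluded minor. If a finite
-- family 𝓕 characterised matroids, take n larger than its members: a minor of 𝒢ₙ isomorphic
-- to some F ∈ 𝓕 would be proper, hence a matroid, whereas F, being its own minor, is not.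
module Submission where

open import Defs
open import Data.Nat using (ℕ; _+_; _≤_; _<_; _⊔_; s≤s; z≤n)
open import Data.Nat.Properties using (≤-trans; ≤-<-trans; m≤m⊔n; m≤n⊔m; m<n+m)
open import Data.Bool using (true)
open import Data.Fin using (Fin; zero; suc)
open import Data.Fin.Properties using (any?; all?; ¬∀⟶∃¬; <⇒notInjective) renaming (_≟_ to _≟ᶠ_)
open import Data.Fin.Subset using (Subset; _∈_; _∉_; _⊆_; _∪_; _─_; ⊤; ⊥; ⁅_⁆; ∁; Nonempty; inside)
open import Data.Fin.Subset.Properties
  using (_∈?_; nonempty?; ∉⊥; ∈⊤; x∈⁅x⁆; x∈⁅y⁆⇒x≡y; x≢y⇒x∉⁅y⁆; x∈p∪q⁺; x∈p∪q⁻; p─q⊆p;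
         ∪-assoc; ∪-identityʳ; ⊆-antisym; x∈p⇒x∉∁p; x∉p⇒x∈∁p)
open import Data.Vec using (_∷_; tabulate; here; there)
open import Data.Vec.Properties using ([]=⇒lookup; lookup⇒[]=; lookup∘tabulate)
open import Data.Product using (Σ; ∃; ∃-syntax; _×_; _,_; proj₁; proj₂)
open import Data.Sum using (_⊎_; inj₁; inj₂; [_,_]′)
open import Data.List using (List; []; _∷_)
open import Data.List.Relation.Unary.Any using (here; there)
open import Data.List.Membership.Propositional using () renaming (_∈_ to _∈ₗ_)
open import Relation.Nullary using (¬_; Dec; yes; no; does; ¬?; _×-dec_; _⊎-dec_; contradiction)
open import Relation.Nullary.Decidable using (dec-true)
open import Relation.Binary.PropositionalEquality using (_≡_; _≢_; refl; sym; trans; cong; subst)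
open import Function using (id; _∘_; Injective)
open import Function.Bundles using (_⇔_; mk⇔; Equivalence)

open Equivalence

private
  variable
    m N : ℕ
    A : Set
    x y i j l : Fin N
    p q r K C S X : Subset N

does≡true⇒ : (a? : Dec A) → does a? ≡ true → A
does≡true⇒ (yes a) _ = a
does≡true⇒ (no _) ()

bounded : (size : A → ℕ) (xs : List A) → ∃[ b ] (∀ {x} → x ∈ₗ xs → size x ≤ b)
bounded size [] = 0 , λ ()
bounded size (x ∷ xs) with bounded size xs
... | b , ≤b = size x ⊔ b , λ { (here refl) → m≤m⊔n (size x) b
                              ; (there x∈xs) → ≤-trans (≤b x∈xs) (m≤n⊔m (size x) b) }

∪-⊆ : p ⊆ r → q ⊆ r → p ∪ q ⊆ r
∪-⊆ {p = p} {q = q} p⊆r q⊆r x∈p∪q = [ p⊆r , q⊆r ]′ (x∈p∪q⁻ p q x∈p∪q)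

∉-∪ : x ∉ p → x ∉ q → x ∉ p ∪ q
∉-∪ {p = p} {q = q} x∉p x∉q x∈p∪q = [ x∉p , x∉q ]′ (x∈p∪q⁻ p q x∈p∪q)

⁅⁆-⊆ : x ∈ p → ⁅ x ⁆ ⊆ p
⁅⁆-⊆ {x = x} x∈p y∈⁅x⁆ = subst (_∈ _) (sym (x∈⁅y⁆⇒x≡y x y∈⁅x⁆)) x∈p

∉-⁅⁆∪ : x ≢ y → x ∉ p → x ∉ ⁅ y ⁆ ∪ p
∉-⁅⁆∪ x≢y = ∉-∪ (x≢y⇒x∉⁅y⁆ x≢y)

x∈⁅x⁆∪p∪q : (x : Fin N) → x ∈ (⁅ x ⁆ ∪ p) ∪ q
x∈⁅x⁆∪p∪q x = x∈p∪q⁺ (inj₁ (x∈p∪q⁺ (inj₁ (x∈⁅x⁆ x))))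

∉⇒≢ : x ∉ S → y ∈ S → x ≢ y
∉⇒≢ x∉S y∈S refl = x∉S y∈S

x∈p─q⇒x∉q : (p q : Subset N) → x ∈ p ─ q → x ∉ q
x∈p─q⇒x∉q (_ ∷ _) (inside ∷ _) () here
x∈p─q⇒x∉q (_ ∷ p) (_ ∷ q) (there x∈p─q) (there x∈q) = x∈p─q⇒x∉q p q x∈p─q x∈q

image : (Fin m → Fin N) → Subset m → Subset N
image f K = tabulate λ y → does (any? λ i → i ∈? K ×-dec f i ≟ᶠ y)

image-isImage : (f : Fin m → Fin N) (K : Subset m) → IsImage f K (image f K)
image-isImage f K y = mk⇔
  (λ y∈ → does≡true⇒ (any? _) (trans (sym (lookup∘tabulate _ y)) ([]=⇒lookup y∈)))
  (λ ∃i → lookup⇒[]= y _ (trans (lookup∘tabulate _ y) (dec-true (any? _) ∃i)))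

module _ {f : Fin m → Fin N} where

  IsImage-∪ : ∀ {K L K′ L′} → IsImage f K K′ → IsImage f L L′ → IsImage f (K ∪ L) (K′ ∪ L′)
  IsImage-∪ {K} {L} {K′} {L′} K′-img L′-img y = mk⇔ image⊆ ⊆image
    where
    image⊆ : y ∈ K′ ∪ L′ → ∃ λ i → i ∈ K ∪ L × f i ≡ y
    image⊆ y∈ with x∈p∪q⁻ K′ L′ y∈
    ... | inj₁ y∈K′ = let i , i∈K , fi≡y = to (K′-img y) y∈K′ in i , x∈p∪q⁺ (inj₁ i∈K) , fi≡y
    ... | inj₂ y∈L′ = let i , i∈L , fi≡y = to (L′-img y) y∈L′ in i , x∈p∪q⁺ (inj₂ i∈L) , fi≡y
    ⊆image : (∃ λ i → i ∈ K ∪ L × f i ≡ y) → y ∈ K′ ∪ L′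
    ⊆image (i , i∈K∪L , fi≡y) with x∈p∪q⁻ K L i∈K∪L
    ... | inj₁ i∈K = x∈p∪q⁺ (inj₁ (from (K′-img y) (i , i∈K , fi≡y)))
    ... | inj₂ i∈L = x∈p∪q⁺ (inj₂ (from (L′-img y) (i , i∈L , fi≡y)))

  IsImage-⁅⁆ : ∀ j → IsImage f ⁅ j ⁆ ⁅ f j ⁆
  IsImage-⁅⁆ j y = mk⇔
    (λ y∈ → j , x∈⁅x⁆ j , sym (x∈⁅y⁆⇒x≡y (f j) y∈))
    (λ { (i , i∈ , refl) → subst (λ k → f i ∈ ⁅ f k ⁆) (x∈⁅y⁆⇒x≡y j i∈) (x∈⁅x⁆ (f i)) })

  IsImage-⊆ : ∀ {K K′} → (∀ i → f i ∈ S) → IsImage f K K′ → K′ ⊆ S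
  IsImage-⊆ f∈S K′-img {y} y∈K′ with to (K′-img y) y∈K′
  ... | i , _ , refl = f∈S i

  module _ (f-inj : Injective _≡_ _≡_ f) where

    IsImage-∉ : ∀ {K K′ i} → IsImage f K K′ → i ∉ K → f i ∉ K′
    IsImage-∉ {i = i} K′-img i∉K fi∈K′ with to (K′-img (f i)) fi∈K′
    ... | k , k∈K , fk≡fi = i∉K (subst (_∈ _) (f-inj fk≡fi) k∈K)

    IsImage-disjoint : ∀ {K L K′ L′} → IsImage f K K′ → IsImage f L L′ →
                       (∀ x → x ∈ K → x ∉ L) → (∀ y → y ∈ K′ → y ∉ L′)
    IsImage-disjoint K′-img L′-img K∩L=∅ y y∈K′ y∈L′ with to (K′-img y) y∈K′
    ... | k , k∈K , refl = IsImage-∉ L′-img (K∩L=∅ k k∈K) y∈L′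

IsImage-id : ∀ {K K′ : Subset N} → IsImage id K K′ → K ≡ K′
IsImage-id {K = K} K′-img = ⊆-antisym
  (λ {x} x∈K → from (K′-img x) (x , x∈K , refl))
  (λ {x} x∈K′ → let i , i∈K , i≡x = to (K′-img x) x∈K′ in subst (_∈ K) i≡x i∈K)

MCIOn : Subset N → Raw N → Set
MCIOn {N} S G = ∀ (i j l : Fin N) (K L : Subset N) →
  i ∈ S → j ∈ S → l ∈ S → K ⊆ S → L ⊆ S →
  i ≢ j → i ≢ l → j ≢ l →
  i ∉ K → j ∉ K → l ∉ K → i ∉ L → j ∉ L → l ∉ L →
  (∀ x → x ∈ K → x ∉ L) →
  ¬ In S G i j K → In S G i l (⁅ j ⁆ ∪ K ∪ L)

SGOn : Subset N → Raw N → Set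
SGOn {N} S G = ∀ (i j l : Fin N) (K : Subset N) →
  i ≢ j → i ≢ l → j ≢ l → i ∉ K → j ∉ K → l ∉ K →
  In S G i j K → In S G i l (⁅ j ⁆ ∪ K) →
  In S G i l K × In S G i j (⁅ l ⁆ ∪ K)

IsMatroidOn : Subset N → Raw N → Set
IsMatroidOn S G = MCIOn S G × SGOn S G

Isomorphic⇒IsMatroid : {H : Raw N} {F : Raw m} → Isomorphic S H F → IsMatroidOn S H → IsMatroid F
Isomorphic⇒IsMatroid {S = S} {H = H} {F = F} (f , f-inj , f∈S , _ , f-In) (mciOn , sgOn) = mci , sg
  where
  img : ∀ K → IsImage f K (image f K)
  img = image-isImage f

  img-⁅⁆∪ : ∀ j K {K′} → IsImage f K K′ → IsImage f (⁅ j ⁆ ∪ K) (⁅ f j ⁆ ∪ K′)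
  img-⁅⁆∪ j K K′-img = IsImage-∪ (IsImage-⁅⁆ j) K′-img

  push : ∀ {i j K K′} → IsImage f K K′ → In ⊤ F i j K → In S H (f i) (f j) K′
  push K′-img = to (f-In _ _ _ _ K′-img)

  pull : ∀ {i j K K′} → IsImage f K K′ → In S H (f i) (f j) K′ → In ⊤ F i j K
  pull K′-img = from (f-In _ _ _ _ K′-img)

  ≢-f : ∀ {i j} → i ≢ j → f i ≢ f j
  ≢-f i≢j = i≢j ∘ f-inj

  ∉-f : ∀ {i} K → i ∉ K → f i ∉ image f K
  ∉-f K = IsImage-∉ f-inj (img K)

  mci : MCI F
  mci i j l K L i≢j i≢l j≢l i∉K j∉K l∉K i∉L j∉L l∉L K∩L=∅ ij|K∉F =
    pull (img-⁅⁆∪ j (K ∪ L) (IsImage-∪ (img K) (img L)))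
      (mciOn (f i) (f j) (f l) (image f K) (image f L) (f∈S i) (f∈S j) (f∈S l)
        (IsImage-⊆ f∈S (img K)) (IsImage-⊆ f∈S (img L)) (≢-f i≢j) (≢-f i≢l) (≢-f j≢l)
        (∉-f K i∉K) (∉-f K j∉K) (∉-f K l∉K) (∉-f L i∉L) (∉-f L j∉L) (∉-f L l∉L)
        (IsImage-disjoint f-inj (img K) (img L) K∩L=∅) (ij|K∉F ∘ pull (img K)))

  sg : SG F
  sg i j l K i≢j i≢l j≢l i∉K j∉K l∉K ij|K∈F il|jK∈F =
    let il|K∈H , ij|lK∈H = sgOn (f i) (f j) (f l) (image f K) (≢-f i≢j) (≢-f i≢l) (≢-f j≢l)
                             (∉-f K i∉K) (∉-f K j∉K) (∉-f K l∉K)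
                             (push (img K) ij|K∈F) (push (img-⁅⁆∪ j K (img K)) il|jK∈F)
    in pull (img K) il|K∈H , pull (img-⁅⁆∪ l K (img K)) ij|lK∈H

Isomorphic-refl : (F : Raw m) → Isomorphic ⊤ F F
Isomorphic-refl F = id , id , (λ _ → ∈⊤) , (λ x _ → x , refl) , In-id
  where
  In-id : ∀ i j K K′ → IsImage id K K′ → In ⊤ F i j K ⇔ In ⊤ F i j K′
  In-id i j K K′ K′-img with IsImage-id K′-img
  ... | refl = mk⇔ id id

smaller-Isomorphic⇒∃∉ : {H : Raw N} {F : Raw m} → m < N → Isomorphic S H F → ∃[ x ] x ∉ S
smaller-Isomorphic⇒∃∉ {N = N} {S = S} m<N (f , _ , _ , f-onto , _) =
  ¬∀⟶∃¬ N (_∈ S) (_∈? S) λ all∈S →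
    let g = λ y → proj₁ (f-onto y (all∈S y))
        f∘g≡id = λ y → proj₂ (f-onto y (all∈S y))
    in <⇒notInjective {f = g} m<N λ {y} {z} gy≡gz →
         trans (sym (f∘g≡id y)) (trans (cong f gy≡gz) (f∘g≡id z))

minor-normalForm : {G H : Raw N} {S′ : Subset N} → Minor S G S′ H →
  ∃[ C ] (S′ ⊆ S × (∀ x → x ∈ C → x ∉ S′) × (∀ i j K → H i j K ≡ G i j (K ∪ C)))
minor-normalForm {G = G} here =
  ⊥ , id , (λ _ x∈⊥ _ → ∉⊥ x∈⊥) , λ i j K → cong (G i j) (sym (∪-identityʳ K))
minor-normalForm (del A _ G⇝H) with minor-normalForm G⇝H
... | C , S′⊆ , C∩S′=∅ , H≗ = C , p─q⊆p _ A ∘ S′⊆ , C∩S′=∅ , H≗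
minor-normalForm {S = S} {G = G} (con A _ G⇝H) with minor-normalForm G⇝H
... | C , S′⊆ , C∩S′=∅ , H≗ =
  C ∪ A , p─q⊆p _ A ∘ S′⊆ , C∪A∩S′=∅ , λ i j K → trans (H≗ i j K) (cong (G i j) (∪-assoc K C A))
  where
  C∪A∩S′=∅ : ∀ x → x ∈ C ∪ A → _
  C∪A∩S′=∅ x x∈C∪A x∈S′ =
    [ (λ x∈C → C∩S′=∅ x x∈C x∈S′) , x∈p─q⇒x∉q S A (S′⊆ x∈S′) ]′ (x∈p∪q⁻ C A x∈C∪A)

IsExcludedMinor : Raw N → Set
IsExcludedMinor G = ¬ IsMatroid G × (∀ {S′ H} → Minor ⊤ G S′ H → ∃[ x ] x ∉ S′ → IsMatroidOn S′ H)

unboundedExcludedMinors⇒¬finiteCharacterisation :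
  (∀ b → ∃[ n ] (b < n × Σ (Raw n) IsExcludedMinor)) →
  ¬ (Σ CIFamily λ 𝓕 → ∀ (n : ℕ) (G : Raw n) → (IsMatroid G ⇔ (¬ HasMinorIn G 𝓕)))
unboundedExcludedMinors⇒¬finiteCharacterisation excluded (𝓕 , characterises)
  with bounded proj₁ 𝓕
... | b , size≤b with excluded b
...   | n , b<n , G , ¬IsMatroid-G , properMinor-IsMatroidOn =
  ¬IsMatroid-G (from (characterises n G) noMinorIn𝓕)
  where
  member-¬IsMatroid : ∀ {F} → F ∈ₗ 𝓕 → ¬ IsMatroid (proj₂ F)
  member-¬IsMatroid {m , F} F∈𝓕 F-matroid =
    to (characterises m F) F-matroid (⊤ , F , here , (m , F) , F∈𝓕 , Isomorphic-refl F)

  noMinorIn𝓕 : ¬ HasMinorIn G 𝓕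
  noMinorIn𝓕 (S′ , H , G⇝H , F , F∈𝓕 , iso) =
    member-¬IsMatroid F∈𝓕 (Isomorphic⇒IsMatroid iso
      (properMinor-IsMatroidOn G⇝H
        (smaller-Isomorphic⇒∃∉ {H = H} (≤-<-trans (size≤b F∈𝓕) b<n) iso)))

Spans : Fin N → Fin N → Subset N → Set
Spans i j X = ∀ x → x ≡ i ⊎ x ≡ j ⊎ x ∈ X

spans? : (i j : Fin N) (X : Subset N) → Dec (Spans i j X)
spans? i j X = all? λ x → x ≟ᶠ i ⊎-dec x ≟ᶠ j ⊎-dec x ∈? X

escapes⇒¬Spans : x ≢ i → x ≢ j → x ∉ X → ¬ Spans i j X
escapes⇒¬Spans {x = x} x≢i x≢j x∉X spans = [ x≢i , [ x≢j , x∉X ]′ ]′ (spans x)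

Spans-sym : Spans i j X → Spans j i X
Spans-sym spans x = [ inj₂ ∘ inj₁ , [ inj₁ , inj₂ ∘ inj₂ ]′ ]′ (spans x)

Spans-exchange : Spans i j (⁅ l ⁆ ∪ X) → Spans i l (⁅ j ⁆ ∪ X)
Spans-exchange {j = j} {l = l} {X = X} spans x with spans x
... | inj₁ x≡i = inj₁ x≡i
... | inj₂ (inj₁ refl) = inj₂ (inj₂ (x∈p∪q⁺ (inj₁ (x∈⁅x⁆ j))))
... | inj₂ (inj₂ x∈lX) with x∈p∪q⁻ ⁅ l ⁆ X x∈lX
...   | inj₁ x∈⁅l⁆ = inj₂ (inj₁ (x∈⁅y⁆⇒x≡y l x∈⁅l⁆))
...   | inj₂ x∈X = inj₂ (inj₂ (x∈p∪q⁺ (inj₂ x∈X)))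

NonemptyNonspanning : Fin N → Fin N → Subset N → Set
NonemptyNonspanning i j X = Nonempty X × ¬ Spans i j X

nonemptyNonspanning : Raw N
nonemptyNonspanning i j X = does (nonempty? X ×-dec ¬? (spans? i j X))

nonemptyNonspanning-true : nonemptyNonspanning i j X ≡ true ⇔ NonemptyNonspanning i j X
nonemptyNonspanning-true {i = i} {j = j} {X = X} =
  mk⇔ (does≡true⇒ nn?) (dec-true nn?)
  where nn? = nonempty? X ×-dec ¬? (spans? i j X)

In-nonemptyNonspanning : {H : Raw N} → (∀ i j K → H i j K ≡ nonemptyNonspanning i j (K ∪ C)) →
  In S H i j K ⇔ (Valid S i j K × NonemptyNonspanning i j (K ∪ C))
In-nonemptyNonspanning {C = C} {i = i} {j = j} {K = K} H≗ = mk⇔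
  (λ { (valid , inj₁ ij) → valid , to nonemptyNonspanning-true (trans (sym (H≗ i j K)) ij)
     ; (valid , inj₂ ji) → valid , swap (to nonemptyNonspanning-true (trans (sym (H≗ j i K)) ji)) })
  (λ (valid , nn) → valid , inj₁ (trans (H≗ i j K) (from nonemptyNonspanning-true nn)))
  where
  swap : NonemptyNonspanning j i (K ∪ C) → NonemptyNonspanning i j (K ∪ C)
  swap (nonempty , ¬spans) = nonempty , ¬spans ∘ Spans-sym

nonemptyNonspanning-¬MCI : {i j l : Fin N} → i ≢ j → i ≢ l → j ≢ l → ¬ MCI (nonemptyNonspanning {N})
nonemptyNonspanning-¬MCI {i = i} {j = j} {l = l} i≢j i≢l j≢l mci =
  il|jL∉G (mci i j l ⊥ rest i≢j i≢l j≢l ∉⊥ ∉⊥ ∉⊥ (∉rest (x∈p∪q⁺ (inj₁ (x∈⁅x⁆ i))))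
              (∉rest (x∈p∪q⁺ (inj₂ (x∈p∪q⁺ (inj₁ (x∈⁅x⁆ j))))))
              (∉rest (x∈p∪q⁺ (inj₂ (x∈p∪q⁺ (inj₂ (x∈⁅x⁆ l))))))
              (λ _ x∈⊥ _ → ∉⊥ x∈⊥) ij|∅∉G)
  where
  ijl = ⁅ i ⁆ ∪ ⁅ j ⁆ ∪ ⁅ l ⁆
  rest = ∁ ijl
  ∉rest : x ∈ ijl → x ∉ rest
  ∉rest = x∈p⇒x∉∁p
  In-G : ∀ {i j K} →
         In ⊤ nonemptyNonspanning i j K ⇔ (Valid ⊤ i j K × NonemptyNonspanning i j (K ∪ ⊥))
  In-G = In-nonemptyNonspanning λ i j K → cong (nonemptyNonspanning i j) (sym (∪-identityʳ K))
  ij|∅∉G : ¬ In ⊤ nonemptyNonspanning i j ⊥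
  ij|∅∉G ij|∅∈G = let (_ , (_ , x∈⊥∪⊥) , _) = to In-G ij|∅∈G in ∉-∪ ∉⊥ ∉⊥ x∈⊥∪⊥
  spans : Spans i l ((⁅ j ⁆ ∪ ⊥ ∪ rest) ∪ ⊥)
  spans x with x ∈? ijl
  ... | no x∉ijl = inj₂ (inj₂ (x∈p∪q⁺ (inj₁ (x∈p∪q⁺ (inj₂ (x∈p∪q⁺ (inj₂ (x∉p⇒x∈∁p x∉ijl))))))))
  ... | yes x∈ijl with x∈p∪q⁻ ⁅ i ⁆ _ x∈ijl
  ...   | inj₁ x∈⁅i⁆ = inj₁ (x∈⁅y⁆⇒x≡y i x∈⁅i⁆)
  ...   | inj₂ x∈jl with x∈p∪q⁻ ⁅ j ⁆ ⁅ l ⁆ x∈jl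
  ...     | inj₁ x∈⁅j⁆ = inj₂ (inj₂ (subst (_∈ _) (sym (x∈⁅y⁆⇒x≡y j x∈⁅j⁆)) (x∈⁅x⁆∪p∪q j)))
  ...     | inj₂ x∈⁅l⁆ = inj₂ (inj₁ (x∈⁅y⁆⇒x≡y l x∈⁅l⁆))
  il|jL∉G : ¬ In ⊤ nonemptyNonspanning i l (⁅ j ⁆ ∪ ⊥ ∪ rest)
  il|jL∉G il|jL∈G = proj₂ (proj₂ (to In-G il|jL∈G)) spans

module _ {S C : Subset N} {H : Raw N} (C∩S=∅ : ∀ x → x ∈ C → x ∉ S)
         (H≗ : ∀ i j K → H i j K ≡ nonemptyNonspanning i j (K ∪ C)) where

  private
    In-H : In S H i j K ⇔ (Valid S i j K × NonemptyNonspanning i j (K ∪ C))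
    In-H = In-nonemptyNonspanning H≗

    ∉C : x ∈ S → x ∉ C
    ∉C x∈S x∈C = C∩S=∅ _ x∈C x∈S

  nonemptyNonspanning-minor-MCIOn : ∃[ x ] x ∉ S → MCIOn S H
  nonemptyNonspanning-minor-MCIOn (x₀ , x₀∉S) i j l K L i∈S j∈S l∈S K⊆S L⊆S
                                  i≢j i≢l j≢l i∉K j∉K l∉K i∉L j∉L l∉L _ ij|K∉H =
    from In-H (valid , (j , x∈⁅x⁆∪p∪q j) , nonspanning)
    where
    J = ⁅ j ⁆ ∪ K ∪ L
    J⊆S : J ⊆ S
    J⊆S = ∪-⊆ (⁅⁆-⊆ j∈S) (∪-⊆ K⊆S L⊆S)
    valid : Valid S i l J
    valid = i∈S , l∈S , J⊆S , i≢l , ∉-⁅⁆∪ i≢j (∉-∪ i∉K i∉L) , ∉-⁅⁆∪ (j≢l ∘ sym) (∉-∪ l∉K l∉L)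
    -- If KC ≠ ∅, l escapes ijKC and so (ij|K) ∈ H after all; otherwise x₀ escapes ilJC.
    nonspanning : ¬ Spans i l (J ∪ C)
    nonspanning with nonempty? (K ∪ C)
    ... | yes K∪C≠∅ = contradiction
          (from In-H ((i∈S , j∈S , K⊆S , i≢j , i∉K , j∉K) , K∪C≠∅ ,
                      escapes⇒¬Spans (i≢l ∘ sym) (j≢l ∘ sym) (∉-∪ l∉K (∉C l∈S))))
          ij|K∉H
    ... | no K∪C=∅ = escapes⇒¬Spans (∉⇒≢ x₀∉S i∈S) (∉⇒≢ x₀∉S l∈S)
          (∉-∪ (x₀∉S ∘ J⊆S) (λ x₀∈C → K∪C=∅ (x₀ , x∈p∪q⁺ (inj₂ x₀∈C))))

  nonemptyNonspanning-minor-SGOn : SGOn S H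
  nonemptyNonspanning-minor-SGOn i j l K i≢j i≢l j≢l i∉K j∉K l∉K ij|K∈H il|jK∈H
    with to In-H ij|K∈H | to In-H il|jK∈H
  ... | (i∈S , j∈S , K⊆S , _) , K∪C≠∅ , _ | (_ , l∈S , _) , _ , ¬spans-il|jK =
    from In-H ((i∈S , l∈S , K⊆S , i≢l , i∉K , l∉K) , K∪C≠∅ ,
               escapes⇒¬Spans (i≢j ∘ sym) j≢l (∉-∪ j∉K (∉C j∈S))) ,
    from In-H ((i∈S , j∈S , ∪-⊆ (⁅⁆-⊆ l∈S) K⊆S , i≢j , ∉-⁅⁆∪ i≢l i∉K , ∉-⁅⁆∪ j≢l j∉K) ,
               (l , x∈⁅x⁆∪p∪q l) , ¬spans-il|jK ∘ exchange)
    where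
    exchange : Spans i j ((⁅ l ⁆ ∪ K) ∪ C) → Spans i l ((⁅ j ⁆ ∪ K) ∪ C)
    exchange = subst (Spans i l) (sym (∪-assoc ⁅ j ⁆ K C)) ∘ Spans-exchange
             ∘ subst (Spans i j) (∪-assoc ⁅ l ⁆ K C)

nonemptyNonspanning-isExcludedMinor : ∀ b → IsExcludedMinor (nonemptyNonspanning {3 + b})
nonemptyNonspanning-isExcludedMinor b =
  nonemptyNonspanning-¬MCI {i = zero} {j = suc zero} {l = suc (suc zero)} (λ ()) (λ ()) (λ ())
    ∘ proj₁ ,
  λ G⇝H proper → let _ , _ , C∩S′=∅ , H≗ = minor-normalForm G⇝H
                 in nonemptyNonspanning-minor-MCIOn C∩S′=∅ H≗ proper ,
                    nonemptyNonspanning-minor-SGOn C∩S′=∅ H≗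

theorem2p4 : ¬ (Σ CIFamily λ 𝓕 → ∀ (n : ℕ) (G : Raw n) → (IsMatroid G ⇔ (¬ HasMinorIn G 𝓕)))
theorem2p4 = unboundedExcludedMinors⇒¬finiteCharacterisation λ b →
  3 + b , m<n+m b (s≤s z≤n) , nonemptyNonspanning , nonemptyNonspanning-isExcludedMinor b
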